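{- Let $\mathcal{S}_K=\{(-1,0),(0,-1),(1,1)\}\subset\mathbb{Z}^2$ (the Kreweras step set), and for $t\ge 0$ and $\mathbf{b}\in\mathbb{Z}^2$ let $F_t^K(\mathbf{b})$ be the number of sequences $s_1s_2\cdots s_t$ of steps $s_i\in\mathcal{S}_K$ with $s_1+\cdots+s_t=\mathbf{b}$ (free Kreweras paths of length $t$ from $(0,0)$ to $\mathbf{b}$, no boundary constraint). Let the isometry group of the free Kreweras paths be the set of matrices $g\in GL_2(\mathbb{Z})$, acting on row vectors by $\mathbf{b}\mapsto \mathbf{b}g$, such that $F_t^K(\mathbf{b}g)=F_t^K(\mathbf{b})$ for all $t\ge0$ and all $\mathbf{b}\in\mathbb{Z}^2$. Then this group is a dihedral group $D_3$ of order six, consisting of the matrices $$g_0=\begin{pmatrix}1&0\\0&1\end{pmatrix},\ g_1=\begin{pmatrix}-1&-1\\0&1\end{pmatrix},\ g_2=\begin{pmatrix}1&0\\-1&-1\end{pmatrix},\ g_3=\begin{pmatrix}-1&-1\\1&0\end{pmatrix},\ g_4=\begin{pmatrix}0&1\\-1&-1\end{pmatrix},\ g_5=\begin{pmatrix}0&1\\1&0\end{pmatrix}.$$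
   Context: Explicitly, writing $\mathbf{b}=(a,b)$, $F_t^K(a,b)=\frac{t!}{n_1!\,n_2!\,n_3!}$ with $n_1=\frac13(t-2a+b)$, $n_2=\frac13(t+a-2b)$, $n_3=\frac13(t+a+b)$ when these are nonnegative integers, and $F_t^K(a,b)=0$ otherwise. Matrices act on the right of row vectors $(a,b)$. -}

module Defs where

open import Data.Integer using (ℤ; +_; -[1+_]; _+_; _*_; -_; _≟_)
open import Data.Nat using (ℕ; zero; suc)
open import Data.List using (List; []; _∷_; map; concatMap; length; filter; foldr)
open import Data.Product using (_×_; _,_)
open import Relation.Binary.PropositionalEquality using (_≡_)
open import Relation.Nullary.Decidable using (_×-dec_)
open import Data.Sum using (_⊎_)

ℤ² : Set
ℤ² = ℤ × ℤ

-1ℤ : ℤ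
-1ℤ = -[1+ 0 ]

_⊕_ : ℤ² → ℤ² → ℤ²
(a , b) ⊕ (c , d) = (a + c , b + d)

kreweras : List ℤ²
kreweras = (-1ℤ , + 0) ∷ (+ 0 , -1ℤ) ∷ (+ 1 , + 1) ∷ []

words : ℕ → List (List ℤ²)
words zero    = [] ∷ []
words (suc t) = concatMap (λ s → map (s ∷_) (words t)) kreweras

endpoint : List ℤ² → ℤ²
endpoint = foldr _⊕_ (+ 0 , + 0)

_≟²_ : (p q : ℤ²) → Relation.Nullary.Decidable.Dec (p ≡ q)
(a , b) ≟² (c , d) = Data.Product.Properties.≡-dec _≟_ _≟_ (a , b) (c , d)
  where import Data.Product.Properties

F : ℕ → ℤ² → ℕ
F t b = length (filter (λ w → endpoint w ≟² b) (words t))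

-- 2×2 integer matrices ((m₁₁ , m₁₂) , (m₂₁ , m₂₂)), rows listed
Mat₂ : Set
Mat₂ = (ℤ × ℤ) × (ℤ × ℤ)

_·_ : ℤ² → Mat₂ → ℤ²
(a , b) · ((p , q) , (r , s)) = (a * p + b * r , a * q + b * s)

_⊗_ : Mat₂ → Mat₂ → Mat₂
((a , b) , (c , d)) ⊗ ((p , q) , (r , s)) =
  ((a * p + b * r , a * q + b * s) , (c * p + d * r , c * q + d * s))

I₂ : Mat₂
I₂ = ((+ 1 , + 0) , (+ 0 , + 1))

GL₂ℤ : Mat₂ → Set
GL₂ℤ g = Data.Product.Σ Mat₂ (λ h → (g ⊗ h ≡ I₂) × (h ⊗ g ≡ I₂))

IsIsometry : Mat₂ → Set
IsIsometry g = ∀ (t : ℕ) (b : ℤ²) → F t (b · g) ≡ F t b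

g₀ g₁ g₂ g₃ g₄ g₅ : Mat₂
g₀ = ((+ 1 , + 0) , (+ 0 , + 1))
g₁ = ((-1ℤ , -1ℤ) , (+ 0 , + 1))
g₂ = ((+ 1 , + 0) , (-1ℤ , -1ℤ))
g₃ = ((-1ℤ , -1ℤ) , (+ 1 , + 0))
g₄ = ((+ 0 , + 1) , (-1ℤ , -1ℤ))
g₅ = ((+ 0 , + 1) , (+ 1 , + 0))

InD₃ : Mat₂ → Set
InD₃ g = g ≡ g₀ ⊎ g ≡ g₁ ⊎ g ≡ g₂ ⊎ g ≡ g₃ ⊎ g ≡ g₄ ⊎ g ≡ g₅

{-# OPTIONS --safe #-}
module Submission where

-- An isometry g preserves F 1, the indicator function of the step set S, so it maps
-- S into S. The rows of g are the images of the negated steps -(-1,0) and -(0,-1), so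
-- they lie in -S; of these nine matrices the three with equal rows send (1,1) to twice
-- a row, which is not a step. Conversely each of the six matrices permutes S, and the
-- recurrence F (t+1) b = Σ_{s ∈ S} F t (b - s) is carried along g by induction on t,
-- the case t = 0 using that g is injective.

open import Defs
open import Data.Integer using (+_; _+_; _*_; -_)
open import Data.Integer.Properties using (neg-involutive)
open import Data.Integer.Tactic.RingSolver using (solve-∀)
open import Data.List using (List; []; _∷_; map; filter; length; concatMap; _++_)
open import Data.List.Properties using (length-++; filter-++; map-∘; map-cong)
open import Data.List.Membership.Propositional using (_∈_)
open import Data.List.Membership.Propositional.Properties using (∈-map⁺; ∈-filter⁻)
open import Data.List.Relation.Binary.Permutation.Propositional
  using (_↭_; refl; prep; swap; trans; ↭-sym)
open import Data.List.Relation.Binary.Permutation.Propositional.Properties using (map⁺)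
open import Data.List.Relation.Unary.Any using (here; there)
open import Data.Nat using (ℕ; zero; suc) renaming (_+_ to _+ℕ_)
open import Data.Nat.ListAction using (sum)
open import Data.Nat.ListAction.Properties using (sum-↭)
open import Data.Product using (_×_; _,_; proj₂; ∃)
open import Data.Sum using (inj₁; inj₂)
open import Function using (_∘_)
open import Function.Bundles using (_⇔_; mk⇔)
open import Relation.Binary.PropositionalEquality
  using (_≡_; refl; sym; cong; cong₂; subst; module ≡-Reasoning)
  renaming (trans to ≡-trans)
open import Relation.Nullary using (yes; no; contradiction)

O : ℤ²
O = (+ 0 , + 0)

neg : ℤ² → ℤ²
neg (a , b) = (- a , - b)

row₁ row₂ : Mat₂ → ℤ²
row₁ (u , _) = u
row₂ (_ , v) = v

neg-involutive² : ∀ x → neg (neg x) ≡ x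
neg-involutive² (a , b) = cong₂ _,_ (neg-involutive a) (neg-involutive b)

⊕-moveʳ : ∀ s e b → s ⊕ e ≡ b → e ≡ b ⊕ neg s
⊕-moveʳ (c , d) (x , y) b refl = cong₂ _,_ (lemma c x) (lemma d y)
  where
  lemma : ∀ c x → x ≡ (c + x) + - c
  lemma = solve-∀

⊕-moveˡ : ∀ s e b → e ≡ b ⊕ neg s → s ⊕ e ≡ b
⊕-moveˡ (c , d) e (a , b) refl = cong₂ _,_ (lemma c a) (lemma d b)
  where
  lemma : ∀ c a → c + (a + - c) ≡ a
  lemma = solve-∀

·-distrib-⊕-neg : ∀ b s g → (b ⊕ neg s) · g ≡ (b · g) ⊕ neg (s · g)
·-distrib-⊕-neg (a , b) (c , d) ((p , q) , (r , s)) =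
  cong₂ _,_ (lemma a c p b d r) (lemma a c q b d s)
  where
  lemma : ∀ a c p b d r → (a + - c) * p + (b + - d) * r ≡ (a * p + b * r) + - (c * p + d * r)
  lemma = solve-∀

·-⊗-assoc : ∀ b g h → (b · g) · h ≡ b · (g ⊗ h)
·-⊗-assoc (x , y) ((a , b) , (c , d)) ((p , q) , (r , s)) =
  cong₂ _,_ (lemma x y a b c d p r) (lemma x y a b c d q s)
  where
  lemma : ∀ x y a b c d p r →
    (x * a + y * c) * p + (x * b + y * d) * r ≡ x * (a * p + b * r) + y * (c * p + d * r)
  lemma = solve-∀

·-identityʳ : ∀ b → b · I₂ ≡ b
·-identityʳ (x , y) = cong₂ _,_ (first x y) (second x y)
  where
  first : ∀ x y → x * + 1 + y * + 0 ≡ x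
  first = solve-∀
  second : ∀ x y → x * + 0 + y * + 1 ≡ y
  second = solve-∀

O·g≡O : ∀ g → O · g ≡ O
O·g≡O ((p , q) , (r , s)) = cong₂ _,_ (lemma p r) (lemma q s)
  where
  lemma : ∀ p r → + 0 * p + + 0 * r ≡ + 0
  lemma = solve-∀

-e₁·g≡-row₁ : ∀ g → (-1ℤ , + 0) · g ≡ neg (row₁ g)
-e₁·g≡-row₁ ((p , q) , (r , s)) = cong₂ _,_ (lemma p r) (lemma q s)
  where
  lemma : ∀ p r → -1ℤ * p + + 0 * r ≡ - p
  lemma = solve-∀

-e₂·g≡-row₂ : ∀ g → (+ 0 , -1ℤ) · g ≡ neg (row₂ g)
-e₂·g≡-row₂ ((p , q) , (r , s)) = cong₂ _,_ (lemma p r) (lemma q s)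
  where
  lemma : ∀ p r → + 0 * p + -1ℤ * r ≡ - r
  lemma = solve-∀

·-kernel-trivial : ∀ {g h} → g ⊗ h ≡ I₂ → ∀ b → b · g ≡ O → b ≡ O
·-kernel-trivial {g} {h} g⊗h≡I b b·g≡O = begin
  b             ≡⟨ ·-identityʳ b ⟨
  b · I₂        ≡⟨ cong (b ·_) g⊗h≡I ⟨
  b · (g ⊗ h)   ≡⟨ ·-⊗-assoc b g h ⟨
  (b · g) · h   ≡⟨ cong (_· h) b·g≡O ⟩
  O · h         ≡⟨ O·g≡O h ⟩
  O             ∎
  where open ≡-Reasoning

count : ℤ² → List (List ℤ²) → ℕ
count b ws = length (filter (λ w → endpoint w ≟² b) ws)

count-++ : ∀ b xs ys → count b (xs ++ ys) ≡ count b xs +ℕ count b ys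
count-++ b xs ys = ≡-trans (cong length (filter-++ _ xs ys)) (length-++ (filter _ xs))

count-prepend : ∀ s b ws → count b (map (s ∷_) ws) ≡ count (b ⊕ neg s) ws
count-prepend s b [] = refl
count-prepend s b (w ∷ ws) with (s ⊕ endpoint w) ≟² b | endpoint w ≟² (b ⊕ neg s)
... | yes _   | yes _ = cong suc (count-prepend s b ws)
... | no _    | no _  = count-prepend s b ws
... | yes s+e | no ¬e = contradiction (⊕-moveʳ s (endpoint w) b s+e) ¬e
... | no ¬s+e | yes e = contradiction (⊕-moveˡ s (endpoint w) b e) ¬s+e

count-extend : ∀ b ws ss →
  count b (concatMap (λ s → map (s ∷_) ws) ss) ≡ sum (map (λ s → count (b ⊕ neg s) ws) ss)
count-extend b ws []       = refl
count-extend b ws (s ∷ ss) =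
  ≡-trans (count-++ b (map (s ∷_) ws) _)
          (cong₂ _+ℕ_ (count-prepend s b ws) (count-extend b ws ss))

F-suc : ∀ t b → F (suc t) b ≡ sum (map (λ s → F t (b ⊕ neg s)) kreweras)
F-suc t b = count-extend b (words t) kreweras

F-zero-cong : ∀ {b c} → (b ≡ O → c ≡ O) → (c ≡ O → b ≡ O) → F 0 b ≡ F 0 c
F-zero-cong {b} {c} b→c c→b with O ≟² b | O ≟² c
... | yes _   | yes _   = refl
... | no _    | no _    = refl
... | yes O≡b | no O≢c  = contradiction (sym (b→c (sym O≡b))) O≢c
... | no O≢b  | yes O≡c = contradiction (sym (c→b (sym O≡c))) O≢b

F-pos⇒reachable : ∀ t x {n} → F t x ≡ suc n → ∃ λ w → w ∈ words t × endpoint w ≡ x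
F-pos⇒reachable t x F≡suc with filter (λ w → endpoint w ≟² x) (words t) in eq
... | w ∷ _ = w , ∈-filter⁻ (λ w → endpoint w ≟² x) (subst (w ∈_) (sym eq) (here refl))

F₁-pos⇒step : ∀ x {n} → F 1 x ≡ suc n → x ∈ kreweras
F₁-pos⇒step x F≡suc with F-pos⇒reachable 1 x F≡suc
... | _ , here refl                 , refl = here refl
... | _ , there (here refl)         , refl = there (here refl)
... | _ , there (there (here refl)) , refl = there (there (here refl))

F₁-step : ∀ {s} → s ∈ kreweras → F 1 s ≡ 1
F₁-step (here refl)                 = refl
F₁-step (there (here refl))         = refl
F₁-step (there (there (here refl))) = refl

isometry-preserves-steps : ∀ {g} → IsIsometry g → ∀ {s} → s ∈ kreweras → s · g ∈ kreweras
isometry-preserves-steps {g} iso {s} s∈S = F₁-pos⇒step (s · g) (≡-trans (iso 1 s) (F₁-step s∈S))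

neg-∈ : ∀ {x xs} → neg x ∈ xs → x ∈ map neg xs
neg-∈ {x} nx∈xs = subst (_∈ _) (neg-involutive² x) (∈-map⁺ neg nx∈xs)

isometry-row₁ : ∀ {g} → IsIsometry g → row₁ g ∈ map neg kreweras
isometry-row₁ {g} iso =
  neg-∈ (subst (_∈ kreweras) (-e₁·g≡-row₁ g) (isometry-preserves-steps iso (here refl)))

isometry-row₂ : ∀ {g} → IsIsometry g → row₂ g ∈ map neg kreweras
isometry-row₂ {g} iso =
  neg-∈ (subst (_∈ kreweras) (-e₂·g≡-row₂ g) (isometry-preserves-steps iso (there (here refl))))

-- In the three refuted cases both rows equal u, and (1,1)·g = 2u is not a step.
rows⇒InD₃ : ∀ {u v} → u ∈ map neg kreweras → v ∈ map neg kreweras →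
  F 1 ((+ 1 , + 1) · (u , v)) ≡ 1 → InD₃ (u , v)
rows⇒InD₃ (here refl)                 (here refl)                 ()
rows⇒InD₃ (here refl)                 (there (here refl))         _ = inj₁ refl
rows⇒InD₃ (here refl)                 (there (there (here refl))) _ = inj₂ (inj₂ (inj₁ refl))
rows⇒InD₃ (there (here refl))         (here refl)                 _ = inj₂ (inj₂ (inj₂ (inj₂ (inj₂ refl))))
rows⇒InD₃ (there (here refl))         (there (here refl))         ()
rows⇒InD₃ (there (here refl))         (there (there (here refl))) _ = inj₂ (inj₂ (inj₂ (inj₂ (inj₁ refl))))
rows⇒InD₃ (there (there (here refl))) (here refl)                 _ = inj₂ (inj₂ (inj₂ (inj₁ refl)))
rows⇒InD₃ (there (there (here refl))) (there (here refl))         _ = inj₂ (inj₁ refl)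
rows⇒InD₃ (there (there (here refl))) (there (there (here refl))) ()

isometry⇒InD₃ : ∀ g → IsIsometry g → InD₃ g
isometry⇒InD₃ g iso =
  rows⇒InD₃ (isometry-row₁ iso) (isometry-row₂ iso) (iso 1 (+ 1 , + 1))

PermutesSteps : Mat₂ → Set
PermutesSteps g = map (_· g) kreweras ↭ kreweras

permutes-steps⇒isometry : ∀ {g} → GL₂ℤ g → PermutesSteps g → IsIsometry g
permutes-steps⇒isometry {g} (h , g⊗h≡I , _) perm = isometry
  where
  open ≡-Reasoning
  isometry : IsIsometry g
  isometry zero    b = F-zero-cong (·-kernel-trivial g⊗h≡I b) λ { refl → O·g≡O g }
  isometry (suc t) b = begin
    F (suc t) (b · g)                           ≡⟨ F-suc t (b · g) ⟩
    sum (map next kreweras)                     ≡⟨ sum-↭ (↭-sym (map⁺ next perm)) ⟩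
    sum (map next (map (_· g) kreweras))        ≡⟨ cong sum (map-∘ {g = next} {f = _· g} kreweras) ⟨
    sum (map (next ∘ (_· g)) kreweras)          ≡⟨ cong sum (map-cong translate kreweras) ⟩
    sum (map (λ s → F t (b ⊕ neg s)) kreweras)  ≡⟨ F-suc t b ⟨
    F (suc t) b                                 ∎
    where
    next : ℤ² → ℕ
    next s = F t ((b · g) ⊕ neg s)
    translate : ∀ s → next (s · g) ≡ F t (b ⊕ neg s)
    translate s = ≡-trans (cong (F t) (sym (·-distrib-⊕-neg b s g))) (isometry t (b ⊕ neg s))

InD₃⇒GL₂ℤ : ∀ {g} → InD₃ g → GL₂ℤ g
InD₃⇒GL₂ℤ (inj₁ refl)                                   = g₀ , refl , refl
InD₃⇒GL₂ℤ (inj₂ (inj₁ refl))                            = g₁ , refl , refl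
InD₃⇒GL₂ℤ (inj₂ (inj₂ (inj₁ refl)))                     = g₂ , refl , refl
InD₃⇒GL₂ℤ (inj₂ (inj₂ (inj₂ (inj₁ refl))))              = g₄ , refl , refl
InD₃⇒GL₂ℤ (inj₂ (inj₂ (inj₂ (inj₂ (inj₁ refl)))))       = g₃ , refl , refl
InD₃⇒GL₂ℤ (inj₂ (inj₂ (inj₂ (inj₂ (inj₂ refl)))))       = g₅ , refl , refl

InD₃⇒permutes-steps : ∀ {g} → InD₃ g → PermutesSteps g
InD₃⇒permutes-steps (inj₁ refl)                             = refl
InD₃⇒permutes-steps (inj₂ (inj₁ refl))                      =
  trans (swap _ _ refl) (trans (prep _ (swap _ _ refl)) (swap _ _ refl))
InD₃⇒permutes-steps (inj₂ (inj₂ (inj₁ refl)))               = prep _ (swap _ _ refl)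
InD₃⇒permutes-steps (inj₂ (inj₂ (inj₂ (inj₁ refl))))        =
  trans (swap _ _ refl) (prep _ (swap _ _ refl))
InD₃⇒permutes-steps (inj₂ (inj₂ (inj₂ (inj₂ (inj₁ refl))))) =
  trans (prep _ (swap _ _ refl)) (swap _ _ refl)
InD₃⇒permutes-steps (inj₂ (inj₂ (inj₂ (inj₂ (inj₂ refl))))) = swap _ _ refl

theorem3 : ∀ (g : Mat₂) → (GL₂ℤ g × IsIsometry g) ⇔ InD₃ g
theorem3 g = mk⇔ (isometry⇒InD₃ g ∘ proj₂) λ g∈D₃ →
  let invertible = InD₃⇒GL₂ℤ g∈D₃ in
  invertible , permutes-steps⇒isometry invertible (InD₃⇒permutes-steps g∈D₃)
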